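{- Let $D$ be a bipartite tournament (an orientation of a complete bipartite graph $K_{m,n}$ with $m,n\ge1$). Then every non-trivial connected component of the $(1,2)$-step competition graph $C_{1,2}(D)$ has diameter at most three.
   Context: For vertices $x,y$ of a digraph $H$, $d_H(x,y)$ denotes the number of arcs in a shortest directed path from $x$ to $y$ in $H$ (if one exists). The $(1,2)$-step competition graph $C_{1,2}(D)$ of a digraph $D$ is the simple graph with vertex set $V(D)$ in which distinct $u,v$ are adjacent if and only if there is a vertex $w\neq u,v$ such that either $d_{D-v}(u,w)\le 1$ and $d_{D-u}(v,w)\le 2$, or $d_{D-u}(v,w)\le 1$ and $d_{D-v}(u,w)\le 2$. A component is non-trivial if it has at least two vertices. -}

module Defs where

open import Data.Nat using (ℕ; suc)
open import Data.Fin using (Fin)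
open import Data.Bool using (Bool; true; false)
open import Data.Sum using (_⊎_; inj₁; inj₂)
open import Data.Product using (_×_; ∃; ∃-syntax)
open import Data.Empty using (⊥)
open import Relation.Binary.PropositionalEquality using (_≡_; _≢_)

-- Walks of length at most k along a relation E (a path of length ≤ k exists
-- iff a walk of length ≤ k exists, so "Walk E k x y" is exactly "d(x,y) ≤ k").
data Walk {V : Set} (E : V → V → Set) : ℕ → V → V → Set where
  here : ∀ {k x} → Walk E k x x
  step : ∀ {k x y z} → E x y → Walk E k y z → Walk E (suc k) x z

Del : {V : Set} → (V → V → Set) → V → V → V → Set
Del A v x y = A x y × x ≢ v × y ≢ v

C12 : {V : Set} → (V → V → Set) → V → V → Set
C12 A u v = u ≢ v × ∃[ w ] (w ≢ u × w ≢ v ×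
  ((Walk (Del A v) 1 u w × Walk (Del A u) 2 v w)
   ⊎ (Walk (Del A u) 1 v w × Walk (Del A v) 2 u w)))

-- A bipartite tournament on parts Fin m and Fin n, given by an orientation
-- o x y = true  means the arc x → y, o x y = false means the arc y → x.
BTArc : {m n : ℕ} → (Fin m → Fin n → Bool) → Fin m ⊎ Fin n → Fin m ⊎ Fin n → Set
BTArc o (inj₁ x) (inj₂ y) = o x y ≡ true
BTArc o (inj₂ y) (inj₁ x) = o x y ≡ false
BTArc o (inj₁ _) (inj₁ _) = ⊥
BTArc o (inj₂ _) (inj₂ _) = ⊥

-- In a bipartite tournament two vertices on the same side are adjacent in
-- C₁,₂(D) iff they have a common out-neighbour, and two vertices on opposite
-- sides iff each has an out-neighbour other than the other one.  Call a vertex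
-- good if it has at least two out-neighbours.  Good vertices on opposite sides
-- are adjacent, and the neighbourhood of a vertex with a single out-neighbour
-- is a clique, so a walk with four edges can be shortened unless its three
-- inner vertices are good.  Then the first and third inner vertices lie on one
-- side, and a case analysis on the sides of the end vertices and a few arc
-- orientations yields a walk of length at most three.  Shortening four-edge
-- walks repeatedly bounds every walk.
module Submission where

open import Defs
open import Data.Nat using (ℕ; _≤_; _+_; suc; s≤s)
open import Data.Nat.Properties using (m≤n+m; m≤m+n)
open import Data.Fin using (Fin)
import Data.Fin.Properties as Fin
open import Data.Bool using (Bool; true; false) renaming (_≟_ to _≟ᵇ_)
open import Data.Bool.Properties using (¬-not)
open import Data.Sum using (_⊎_; inj₁; inj₂)
open import Data.Sum.Properties using (≡-dec)
open import Data.Product using (∃; ∃-syntax; _×_; _,_; proj₁; proj₂)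
open import Data.Empty using (⊥-elim)
open import Relation.Nullary using (¬_; Dec; yes; no)
open import Relation.Nullary.Decidable using (map′; _×-dec_; _⊎-dec_; ¬?)
open import Relation.Unary using (Decidable)
open import Relation.Binary using (DecidableEquality)
open import Relation.Binary.PropositionalEquality using (_≡_; _≢_; refl; sym; trans; subst; ≢-sym)

module _ {V : Set} {E : V → V → Set} where

  walk-mono : ∀ {j k u v} → j ≤ k → Walk E j u v → Walk E k u v
  walk-mono _         here       = here
  walk-mono (s≤s j≤k) (step e p) = step e (walk-mono j≤k p)

  _++_ : ∀ {j k u v w} → Walk E j u v → Walk E k v w → Walk E (j + k) u w
  _++_ {j} {k} here q = walk-mono (m≤n+m k j) q
  step e p ++ q       = step e (p ++ q)

  walk-snoc : ∀ {k u v w} → Walk E k u v → E v w → Walk E (suc k) u w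
  walk-snoc here       e = step e here
  walk-snoc (step d p) e = step d (walk-snoc p e)

  walk-reverse : (∀ {x y} → E x y → E y x) → ∀ {k u v} → Walk E k u v → Walk E k v u
  walk-reverse E-sym here       = here
  walk-reverse E-sym (step e p) = walk-snoc (walk-reverse E-sym p) (E-sym e)

  shorten-to-3 : (∀ {a b c d e} → E a b → E b c → E c d → E d e → Walk E 3 a e)
               → ∀ {k u v} → Walk E k u v → Walk E 3 u v
  shorten-to-3 shortcut here = here
  shorten-to-3 shortcut (step e p) with shorten-to-3 shortcut p
  ... | here                             = step e here
  ... | step e₁ here                     = step e (step e₁ here)
  ... | step e₁ (step e₂ here)           = step e (step e₁ (step e₂ here))
  ... | step e₁ (step e₂ (step e₃ here)) = shortcut e e₁ e₂ e₃

C12-sym : ∀ {V : Set} {A : V → V → Set} {u v} → C12 A u v → C12 A v u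
C12-sym (u≢v , w , w≢u , w≢v , inj₁ uw) = ≢-sym u≢v , w , w≢v , w≢u , inj₂ uw
C12-sym (u≢v , w , w≢u , w≢v , inj₂ vw) = ≢-sym u≢v , w , w≢v , w≢u , inj₁ vw

module BipartiteTournament {m n : ℕ} (o : Fin m → Fin n → Bool) where

  V : Set
  V = Fin m ⊎ Fin n

  A : V → V → Set
  A = BTArc o

  infix 4 _~_
  _~_ : V → V → Set
  _~_ = C12 A

  _≟_ : DecidableEquality V
  _≟_ = ≡-dec Fin._≟_ Fin._≟_

  side : V → Bool
  side (inj₁ _) = false
  side (inj₂ _) = true

  SameSide Opposite : V → V → Set
  SameSide u v = side u ≡ side v
  Opposite u v = side u ≢ side v

  same-side? : ∀ u v → Dec (SameSide u v)
  same-side? u v = side u ≟ᵇ side v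

  same-opposite : ∀ {u v w} → SameSide u v → Opposite v w → Opposite u w
  same-opposite u=v v|w e = v|w (trans (sym u=v) e)

  opposite-same : ∀ {u v w} → Opposite u v → SameSide v w → Opposite u w
  opposite-same u|v v=w e = u|v (trans e (sym v=w))

  opposite-opposite : ∀ {u v w} → Opposite u v → Opposite v w → SameSide u w
  opposite-opposite u|v v|w = trans (¬-not u|v) (sym (¬-not (≢-sym v|w)))

  arc-opposite : ∀ {u v} → A u v → Opposite u v
  arc-opposite {inj₁ _} {inj₂ _} _ ()
  arc-opposite {inj₂ _} {inj₁ _} _ ()

  arc-irrefl : ∀ {u v} → A u v → u ≢ v
  arc-irrefl a refl = arc-opposite a refl

  arc-asym : ∀ {u v} → A u v → ¬ A v u
  arc-asym {inj₁ _} {inj₂ _} uv vu with () ← trans (sym uv) vu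
  arc-asym {inj₂ _} {inj₁ _} uv vu with () ← trans (sym vu) uv

  arc-total : ∀ {u v} → Opposite u v → A u v ⊎ A v u
  arc-total {inj₁ _} {inj₁ _} u|v = ⊥-elim (u|v refl)
  arc-total {inj₂ _} {inj₂ _} u|v = ⊥-elim (u|v refl)
  arc-total {inj₁ x} {inj₂ y} _ with o x y
  ... | true  = inj₁ refl
  ... | false = inj₂ refl
  arc-total {inj₂ y} {inj₁ x} _ with o x y
  ... | true  = inj₂ refl
  ... | false = inj₁ refl

  arc? : ∀ u v → Dec (A u v)
  arc? (inj₁ _) (inj₁ _) = no λ ()
  arc? (inj₂ _) (inj₂ _) = no λ ()
  arc? (inj₁ x) (inj₂ y) = o x y ≟ᵇ true
  arc? (inj₂ y) (inj₁ x) = o x y ≟ᵇ false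

  ∃? : ∀ {P : V → Set} → Decidable P → Dec (∃ P)
  ∃? {P} P? = map′ merge split (Fin.any? (λ x → P? (inj₁ x)) ⊎-dec Fin.any? (λ y → P? (inj₂ y)))
    where
    merge : (∃[ x ] P (inj₁ x)) ⊎ (∃[ y ] P (inj₂ y)) → ∃ P
    merge (inj₁ (x , p)) = inj₁ x , p
    merge (inj₂ (y , p)) = inj₂ y , p
    split : ∃ P → (∃[ x ] P (inj₁ x)) ⊎ (∃[ y ] P (inj₂ y))
    split (inj₁ x , p) = inj₁ (x , p)
    split (inj₂ y , p) = inj₂ (y , p)

  Beyond : V → V → Set
  Beyond v w = ∃[ z ] A v z × z ≢ w

  -- Equivalently: v has at least two out-neighbours.
  Good : V → Set
  Good v = ∀ w → Beyond v w

  Thin : V → V → Set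
  Thin t a = A t a × (∀ {b} → A t b → b ≡ a)

  beyond? : ∀ v w → Dec (Beyond v w)
  beyond? v w = ∃? (λ z → arc? v z ×-dec ¬? (z ≟ w))

  two-outs⇒good : ∀ {v a b} → A v a → A v b → a ≢ b → Good v
  two-outs⇒good {a = a} va vb a≢b w with a ≟ w
  ... | yes refl = _ , vb , ≢-sym a≢b
  ... | no a≢w   = a , va , a≢w

  good-or-thin : ∀ {v a} → A v a → Good v ⊎ Thin v a
  good-or-thin {v} {a} va with beyond? v a
  ... | yes (b , vb , b≢a) = inj₁ (two-outs⇒good vb va b≢a)
  ... | no ¬beyond         = inj₂ (va , only-a)
    where
    only-a : ∀ {b} → A v b → b ≡ a
    only-a {b} vb with b ≟ a
    ... | yes b≡a = b≡a
    ... | no b≢a  = ⊥-elim (¬beyond (b , vb , b≢a))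

  same-side-half : ∀ {u v w} → SameSide u v → w ≢ u → w ≢ v
                 → Walk (Del A v) 1 u w → Walk (Del A u) 2 v w → A u w × A v w
  same-side-half _ w≢u _ here _ = ⊥-elim (w≢u refl)
  same-side-half _ _ w≢v (step _ here) here = ⊥-elim (w≢v refl)
  same-side-half _ _ _ (step (uw , _) here) (step (vw , _) here) = uw , vw
  same-side-half u=v _ _ (step (uw , _) here) (step (vz , _) (step (zw , _) here)) =
    ⊥-elim (arc-opposite uw (trans u=v (opposite-opposite (arc-opposite vz) (arc-opposite zw))))

  opposite-half : ∀ {u v w} → Opposite u v → w ≢ u → w ≢ v
                → Walk (Del A v) 1 u w → Walk (Del A u) 2 v w → Beyond u v × Beyond v u
  opposite-half _ w≢u _ here _ = ⊥-elim (w≢u refl)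
  opposite-half _ _ w≢v (step _ here) here = ⊥-elim (w≢v refl)
  opposite-half u|v _ _ (step (uw , _) here) (step (vw , _) here) =
    ⊥-elim (arc-opposite uw (opposite-opposite u|v (arc-opposite vw)))
  opposite-half _ _ w≢v (step (uw , _) here) (step (vz , _ , z≢u) (step _ here)) =
    (_ , uw , w≢v) , (_ , vz , z≢u)

  ~⇒common-out : ∀ {u v} → SameSide u v → u ~ v → ∃[ w ] A u w × A v w
  ~⇒common-out u=v (_ , w , w≢u , w≢v , inj₁ (p , q)) = w , same-side-half u=v w≢u w≢v p q
  ~⇒common-out u=v (_ , w , w≢u , w≢v , inj₂ (q , p)) with same-side-half (sym u=v) w≢v w≢u q p
  ... | vw , uw = w , uw , vw

  ~⇒beyond : ∀ {u v} → Opposite u v → u ~ v → Beyond u v × Beyond v u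
  ~⇒beyond u|v (_ , w , w≢u , w≢v , inj₁ (p , q)) = opposite-half u|v w≢u w≢v p q
  ~⇒beyond u|v (_ , w , w≢u , w≢v , inj₂ (q , p)) with opposite-half (≢-sym u|v) w≢v w≢u q p
  ... | v>u , u>v = u>v , v>u

  out-arc : ∀ {u v} → u ~ v → ∃[ a ] A u a
  out-arc (_ , _ , w≢u , _ , inj₁ (here , _))          = ⊥-elim (w≢u refl)
  out-arc (_ , _ , _ , _ , inj₁ (step (ua , _) _ , _)) = _ , ua
  out-arc (_ , _ , w≢u , _ , inj₂ (_ , here))          = ⊥-elim (w≢u refl)
  out-arc (_ , _ , _ , _ , inj₂ (_ , step (uz , _) _)) = _ , uz

  common-out⇒~ : ∀ {u v w} → u ≢ v → A u w → A v w → u ~ v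
  common-out⇒~ {u} {v} {w} u≢v uw vw =
    u≢v , w , w≢u , w≢v , inj₁ (step (uw , u≢v , w≢v) here , step (vw , ≢-sym u≢v , w≢u) here)
    where
    w≢u : w ≢ u
    w≢u = ≢-sym (arc-irrefl uw)
    w≢v : w ≢ v
    w≢v = ≢-sym (arc-irrefl vw)

  common-out⇒walk₁ : ∀ {u v w} → A u w → A v w → Walk _~_ 1 u v
  common-out⇒walk₁ {u} {v} uw vw with u ≟ v
  ... | yes refl = here
  ... | no u≢v   = step (common-out⇒~ u≢v uw vw) here

  beyond⇒~ : ∀ {u v} → Opposite u v → Beyond u v → Beyond v u → u ~ v
  beyond⇒~ {u} {v} u|v (w , uw , w≢v) (z , vz , z≢u) = witness (arc-total z|w)
    where
    u≢v : u ≢ v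
    u≢v refl = u|v refl
    w≢u : w ≢ u
    w≢u = ≢-sym (arc-irrefl uw)
    z≢v : z ≢ v
    z≢v = ≢-sym (arc-irrefl vz)
    z|w : Opposite z w
    z|w = same-opposite (sym (opposite-opposite u|v (arc-opposite vz))) (arc-opposite uw)
    witness : A z w ⊎ A w z → u ~ v
    witness (inj₁ zw) = u≢v , w , w≢u , w≢v ,
      inj₁ (step (uw , u≢v , w≢v) here , step (vz , ≢-sym u≢v , z≢u) (step (zw , z≢u , w≢u) here))
    witness (inj₂ wz) = u≢v , z , z≢u , z≢v ,
      inj₂ (step (vz , ≢-sym u≢v , z≢u) here , step (uw , u≢v , w≢v) (step (wz , w≢v , z≢v) here))

  beyond-good⇒~ : ∀ {u g} → Good g → Opposite u g → Beyond u g → u ~ g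
  beyond-good⇒~ {u} good-g u|g u>g = beyond⇒~ u|g u>g (good-g u)

  good-opposite⇒~ : ∀ {g h} → Good g → Good h → Opposite g h → g ~ h
  good-opposite⇒~ {g} {h} good-g good-h g|h = beyond-good⇒~ good-h g|h (good-g h)

  thin-same-side-neighbour : ∀ {t a p} → Thin t a → SameSide p t → p ~ t → A p a
  thin-same-side-neighbour {p = p} (_ , only-a) p=t pt with ~⇒common-out p=t pt
  ... | _ , pw , tw = subst (A p) (only-a tw) pw

  thin-opposite-neighbour : ∀ {t a p} → Thin t a → Opposite p t → p ~ t → A p t × Good p
  thin-opposite-neighbour (_ , only-a) p|t pt with ~⇒beyond p|t pt | arc-total p|t
  ... | (_ , pz , z≢t) , _ | inj₁ pt′ = pt′ , two-outs⇒good pt′ pz (≢-sym z≢t)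
  ... | _ , (_ , tz , z≢p) | inj₂ tp  = ⊥-elim (z≢p (trans (only-a tz) (sym (only-a tp))))

  thin-neighbour : ∀ {t a p} → Thin t a → p ~ t → A p a ⊎ (A p t × Good p)
  thin-neighbour {t} {p = p} thin pt with same-side? p t
  ... | yes p=t = inj₁ (thin-same-side-neighbour thin p=t pt)
  ... | no p|t  = inj₂ (thin-opposite-neighbour thin p|t pt)

  arc-pair⇒~ : ∀ {t a p q} → A t a → A p a → A q t → Good q → p ~ q
  arc-pair⇒~ {a = a} {p} {q} ta pa qt good-q = beyond-good⇒~ good-q p|q (a , pa , a≢q)
    where
    a≢q : a ≢ q
    a≢q refl = arc-asym ta qt
    p|q : Opposite p q
    p|q = same-opposite (opposite-opposite (arc-opposite pa) (≢-sym (arc-opposite ta)))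
                        (≢-sym (arc-opposite qt))

  thin-simplicial : ∀ {t a p q} → Thin t a → p ~ t → q ~ t → Walk _~_ 1 p q
  thin-simplicial thin@(ta , _) pt qt with thin-neighbour thin pt | thin-neighbour thin qt
  ... | inj₁ pa             | inj₁ qa             = common-out⇒walk₁ pa qa
  ... | inj₂ (pt′ , _)      | inj₂ (qt′ , _)      = common-out⇒walk₁ pt′ qt′
  ... | inj₁ pa             | inj₂ (qt′ , good-q) = step (arc-pair⇒~ ta pa qt′ good-q) here
  ... | inj₂ (pt′ , good-p) | inj₁ qa             = step (C12-sym (arc-pair⇒~ ta qa pt′ good-p)) here

  opposite-end : ∀ {g u a v} → Good g → Opposite u g → A u a → g ~ v → SameSide g v → Walk _~_ 2 u v
  opposite-end {g} {u} {a} good-g u|g ua gv g=v with ~⇒common-out g=v gv | a ≟ g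
  ... | _ | no a≢g = step (beyond-good⇒~ good-g u|g (a , ua , a≢g)) (step gv here)
  ... | d , gd , vd | yes refl =
        step (beyond⇒~ (opposite-same u|g g=v) (g , ua , proj₁ gv) (d , vd , d≢u)) here
    where
    d≢u : d ≢ u
    d≢u refl = arc-asym gd ua

  same-side-ends : ∀ {g u p v} → Good g → u ~ p → SameSide u g → SameSide p g → g ~ v → SameSide g v
                 → Walk _~_ 3 u v
  same-side-ends good-g up u=g p=g gv g=v with out-arc up | ~⇒common-out g=v gv
  ... | c , uc | d , gd , vd with arc-total (same-opposite u=g (arc-opposite gd))
  ...   | inj₁ ud = walk-mono (m≤m+n 1 2) (common-out⇒walk₁ ud vd)
  ...   | inj₂ du with arc-total (same-opposite p=g (arc-opposite gd))
  ...     | inj₁ pd = walk-mono (m≤m+n 2 1) (step up (common-out⇒walk₁ pd vd))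
  ...     | inj₂ dp =
            step (beyond-good⇒~ good-d (same-opposite u=g (arc-opposite gd)) (c , uc , c≢d))
                 (step (good-opposite⇒~ good-d good-g (≢-sym (arc-opposite gd))) (step gv here))
    where
    c≢d : c ≢ d
    c≢d refl = arc-asym uc du
    good-d : Good d
    good-d = two-outs⇒good du dp (proj₁ up)

  pinned-ends : ∀ {p₀ p₁ p₂ p₃ p₄} → Good p₂ → SameSide p₁ p₃ → Opposite p₀ p₁ → A p₀ p₃ → A p₄ p₁
              → p₀ ~ p₁ → p₁ ~ p₂ → p₂ ~ p₃ → p₃ ~ p₄ → Walk _~_ 3 p₀ p₄
  pinned-ends {p₁ = p₁} {p₂} good-p₂ p₁=p₃ p₀|p₁ p₀p₃ p₄p₁ e₀₁ e₁₂ e₂₃ e₃₄ with same-side? p₂ p₁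
  ... | yes p₂=p₁ =
        step (beyond-good⇒~ good-p₂ (opposite-same p₀|p₁ (sym p₂=p₁)) (_ , p₀p₃ , ≢-sym (proj₁ e₂₃)))
             (step e₂₃ (step e₃₄ here))
  ... | no p₂|p₁ with arc-total (opposite-same p₂|p₁ p₁=p₃)
  ...   | inj₁ p₂p₃ = common-out⇒walk₁ p₀p₃ p₂p₃ ++ step e₂₃ (step e₃₄ here)
  ...   | inj₂ p₃p₂ with arc-total (≢-sym p₂|p₁)
  ...     | inj₁ p₁p₂ = step e₀₁ (common-out⇒walk₁ p₁p₂ p₃p₂ ++ step e₃₄ here)
  ...     | inj₂ p₂p₁ = step e₀₁ (step e₁₂ (common-out⇒walk₁ p₂p₁ p₄p₁))

  opposite-ends : ∀ {p₀ p₁ p₂ p₃ p₄} → Good p₁ → Good p₂ → Good p₃ → SameSide p₁ p₃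
                → Opposite p₀ p₁ → Opposite p₄ p₃
                → p₀ ~ p₁ → p₁ ~ p₂ → p₂ ~ p₃ → p₃ ~ p₄ → Walk _~_ 3 p₀ p₄
  opposite-ends {p₁ = p₁} {p₃ = p₃} g₁ g₂ g₃ p₁=p₃ p₀|p₁ p₄|p₃ e₀₁ e₁₂ e₂₃ e₃₄
    with out-arc e₀₁ | out-arc (C12-sym e₃₄)
  ... | a , p₀a | b , p₄b with a ≟ p₃ | b ≟ p₁
  ...   | no a≢p₃ | _ = walk-mono (m≤m+n 2 1)
          (step (beyond-good⇒~ g₃ (opposite-same p₀|p₁ p₁=p₃) (a , p₀a , a≢p₃)) (step e₃₄ here))
  ...   | yes refl | no b≢p₁ = walk-mono (m≤m+n 2 1)
          (step e₀₁ (step (C12-sym (beyond-good⇒~ g₁ (opposite-same p₄|p₃ (sym p₁=p₃)) (b , p₄b , b≢p₁))) here))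
  ...   | yes refl | yes refl = pinned-ends g₂ p₁=p₃ p₀|p₁ p₀a p₄b e₀₁ e₁₂ e₂₃ e₃₄

  good-four-step-shortcut : ∀ {p₀ p₁ p₂ p₃ p₄} → Good p₁ → Good p₂ → Good p₃
                          → p₀ ~ p₁ → p₁ ~ p₂ → p₂ ~ p₃ → p₃ ~ p₄ → Walk _~_ 3 p₀ p₄
  good-four-step-shortcut {p₀} {p₁} {_} {p₃} {p₄} g₁ g₂ g₃ e₀₁ e₁₂ e₂₃ e₃₄ with same-side? p₁ p₃
  ... | no p₁|p₃ = step e₀₁ (step (good-opposite⇒~ g₁ g₃ p₁|p₃) (step e₃₄ here))
  ... | yes p₁=p₃ with same-side? p₀ p₁ | same-side? p₄ p₃
  ...   | yes p₀=p₁ | yes p₄=p₃ = same-side-ends g₃ e₀₁ (trans p₀=p₁ p₁=p₃) p₁=p₃ e₃₄ (sym p₄=p₃)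
  ...   | no p₀|p₁  | yes p₄=p₃ = walk-mono (m≤m+n 2 1)
          (opposite-end g₃ (opposite-same p₀|p₁ p₁=p₃) (proj₂ (out-arc e₀₁)) e₃₄ (sym p₄=p₃))
  ...   | yes p₀=p₁ | no p₄|p₃  = walk-reverse C12-sym (walk-mono (m≤m+n 2 1)
          (opposite-end g₁ (opposite-same p₄|p₃ (sym p₁=p₃)) (proj₂ (out-arc (C12-sym e₃₄)))
                        (C12-sym e₀₁) (sym p₀=p₁)))
  ...   | no p₀|p₁  | no p₄|p₃  = opposite-ends g₁ g₂ g₃ p₁=p₃ p₀|p₁ p₄|p₃ e₀₁ e₁₂ e₂₃ e₃₄

  four-step-shortcut : ∀ {p₀ p₁ p₂ p₃ p₄} → p₀ ~ p₁ → p₁ ~ p₂ → p₂ ~ p₃ → p₃ ~ p₄ → Walk _~_ 3 p₀ p₄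
  four-step-shortcut e₀₁ e₁₂ e₂₃ e₃₄
    with good-or-thin (proj₂ (out-arc e₁₂)) | good-or-thin (proj₂ (out-arc e₂₃))
       | good-or-thin (proj₂ (out-arc e₃₄))
  ... | inj₂ thin₁ | _          | _          = thin-simplicial thin₁ e₀₁ (C12-sym e₁₂) ++ step e₂₃ (step e₃₄ here)
  ... | inj₁ _     | inj₂ thin₂ | _          = step e₀₁ (thin-simplicial thin₂ e₁₂ (C12-sym e₂₃) ++ step e₃₄ here)
  ... | inj₁ _     | inj₁ _     | inj₂ thin₃ = step e₀₁ (step e₁₂ (thin-simplicial thin₃ e₂₃ (C12-sym e₃₄)))
  ... | inj₁ g₁    | inj₁ g₂    | inj₁ g₃    = good-four-step-shortcut g₁ g₂ g₃ e₀₁ e₁₂ e₂₃ e₃₄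

theorem2p9 : (m n : ℕ) → 1 ≤ m → 1 ≤ n → (o : Fin m → Fin n → Bool)
    → (u v : Fin m ⊎ Fin n)
    → ∃[ k ] Walk (C12 (BTArc o)) k u v
    → Walk (C12 (BTArc o)) 3 u v
theorem2p9 m n _ _ o u v (_ , w) = shorten-to-3 four-step-shortcut w
  where open BipartiteTournament o
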